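{- Let $m\in\mathbb{N}\setminus\{0,1\}$ and $T\in\mathcal{L}_m$. Then the set of children of $T$ in the tree $G(m)$ is $$\left\{T\setminus A \;\middle|\; \emptyset\neq A\subseteq\left\{x\in\mathrm{msg}(T)\;\middle|\; x>\left(\left\lfloor\tfrac{\mathrm{F}(T)}{\mathrm{m}(T)}\right\rfloor+1\right)m\right\}\right\}.$$
   Context: A numerical semigroup is a subset $S\subseteq\mathbb{N}$ containing $0$, closed under addition, with finite complement in $\mathbb{N}$; $\mathrm{F}(S)=\max(\mathbb{Z}\setminus S)$, $\mathrm{m}(S)=\min(S\setminus\{0\})$; $\mathrm{msg}(T)$ is the (unique, finite) minimal system of generators of $T$ as a monoid. $\mathcal{L}_m$ is the set of numerical semigroups with multiplicity $m$. For $S\ne\mathbb{N}$, $\gamma(S)=\{x\in\mathbb{N}\setminus S\mid \lfloor \mathrm{F}(S)/\mathrm{m}(S)\rfloor\,\mathrm{m}(S)\le x\le\mathrm{F}(S)\}$. $G(m)$ is the directed graph with vertex set $\mathcal{L}_m$ in which $(S,T)$ is an edge iff $S\ne T$ and $T=S\cup\gamma(S)$; it is a tree with root $\{0\}\cup\{x\in\mathbb{N}\mid x\ge m\}$, and $S$ is a child of $T$ iff $(S,T)$ is an edge. -}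

module Defs where

open import Data.Nat using (ℕ; zero; suc; _+_; _*_; _≤_; _<_; NonZero)
open import Data.Nat.DivMod using (_/_)
open import Data.Bool using (Bool; true; false)
open import Data.Product using (Σ; _×_; _,_; ∃; ∃-syntax)
open import Data.Sum using (_⊎_)
open import Relation.Nullary using (¬_)
open import Relation.Binary.PropositionalEquality using (_≡_)
open import Function.Bundles using (_⇔_)

SubsetN : Set
SubsetN = ℕ → Bool

infix 4 _∈_ _∉_
_∈_ : ℕ → SubsetN → Set
x ∈ S = S x ≡ true

_∉_ : ℕ → SubsetN → Set
x ∉ S = ¬ (x ∈ S)

SameSet : SubsetN → SubsetN → Set
SameSet S T = ∀ x → (x ∈ S) ⇔ (x ∈ T)

_∖_ : SubsetN → SubsetN → SubsetN
(T ∖ A) x with T x | A x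
... | true | false = true
... | _    | _     = false

IsNumericalSemigroup : SubsetN → Set
IsNumericalSemigroup S =
  (0 ∈ S)
  × (∀ a b → a ∈ S → b ∈ S → (a + b) ∈ S)
  × (∃[ N ] (∀ x → N ≤ x → x ∈ S))

-- f = F(S) (for S ≠ ℕ, so F(S) ∈ ℕ): the largest natural number not in S.
IsFrobenius : SubsetN → ℕ → Set
IsFrobenius S f = (f ∉ S) × (∀ x → f < x → x ∈ S)

IsMultiplicity : SubsetN → ℕ → Set
IsMultiplicity S k = (0 < k) × (k ∈ S) × (∀ x → 0 < x → x < k → x ∉ S)

InMsg : SubsetN → ℕ → Set
InMsg S x =
  (x ∈ S) × (0 < x)
  × ¬ (∃[ a ] ∃[ b ] ((a ∈ S) × (b ∈ S) × (0 < a) × (0 < b) × (a + b ≡ x)))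

-- γ(S) for S ∈ L_m (so m(S) = m), S ≠ ℕ:
-- { x ∉ S | ⌊F(S)/m⌋ m ≤ x ≤ F(S) }.
InGamma : (m : ℕ) → .{{_ : NonZero m}} → SubsetN → ℕ → Set
InGamma m S x = (x ∉ S) × (∃[ f ] (IsFrobenius S f × ((f / m) * m ≤ x) × (x ≤ f)))

IsChild : (m : ℕ) → .{{_ : NonZero m}} → SubsetN → SubsetN → Set
IsChild m T S =
  IsNumericalSemigroup S × IsMultiplicity S m
  × ¬ SameSet S T
  × (∀ x → (x ∈ T) ⇔ ((x ∈ S) ⊎ InGamma m S x))

Removable : (m : ℕ) → .{{_ : NonZero m}} → SubsetN → ℕ → ℕ → Set
Removable m T f x = InMsg T x × ((f / m + 1) * m < x)

{-# OPTIONS --safe #-}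
module Submission where

-- Write q = ⌊F(T)/m⌋. A minimal generator of T is at most F(T) + m (else subtract m), so
-- removing a nonempty set A of minimal generators x > (q + 1) m leaves a numerical semigroup
-- S = T ∖ A of multiplicity m with (q + 1) m < F(S) ≤ F(T) + m < (q + 2) m. Hence
-- ⌊F(S)/m⌋ = q + 1, and since every gap of T is below (q + 1) m, γ(S) = A: T = S ∪ γ(S).
-- Conversely, if T = S ∪ γ(S) and p = ⌊F(S)/m⌋, then F(T) < p m (otherwise F(T) ∈ γ(S) ⊆ T),
-- so q < p and every x ∈ T ∖ S lies in the window p m < x ≤ F(S) < (p + 1) m. A decomposition
-- x = a + b in T needs a summand a ∉ S, which lies in the window too, leaving 0 < b < m in T.
-- So T ∖ S consists of minimal generators of T beyond (q + 1) m.

open import Defs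
open import Data.Nat using (ℕ; zero; suc; _+_; _*_; _∸_; _≤_; _<_; NonZero; z≤n; s≤s; s≤s⁻¹; z<s)
open import Data.Nat.Properties
open import Data.Nat.DivMod
  using (_/_; _%_; m≡m%n+[m/n]*n; m%n<n; m/n*n≤m; m*n/n≡m; /-monoˡ-≤; m<n*o⇒m/o<n)
open import Data.Bool using (true; false)
open import Data.Bool.Properties using (¬-not)
open import Data.Product using (_×_; _,_; ∃-syntax; proj₁; proj₂)
open import Data.Sum using (_⊎_; inj₁; inj₂)
open import Relation.Nullary using (¬_; contradiction)
open import Relation.Binary.PropositionalEquality using (_≡_; _≢_; refl; sym; trans; subst; cong)
open import Function.Bundles using (_⇔_; mk⇔; Equivalence)

[m+1]*n≡m*n+n : ∀ m n → (m + 1) * n ≡ m * n + n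
[m+1]*n≡m*n+n m n = trans (*-distribʳ-+ n m 1) (cong (m * n +_) (*-identityˡ n))

m<[m/n+1]*n : ∀ m n .{{_ : NonZero n}} → m < (m / n + 1) * n
m<[m/n+1]*n m n = begin-strict
  m                  ≡⟨ m≡m%n+[m/n]*n m n ⟩
  m % n + m / n * n  <⟨ +-monoˡ-< (m / n * n) (m%n<n m n) ⟩
  n + m / n * n      ≡⟨ +-comm n (m / n * n) ⟩
  m / n * n + n      ≡⟨ [m+1]*n≡m*n+n (m / n) n ⟨
  (m / n + 1) * n    ∎
  where open ≤-Reasoning

m*n≤o⇒m≤o/n : ∀ m n o .{{_ : NonZero n}} → m * n ≤ o → m ≤ o / n
m*n≤o⇒m≤o/n m n o le = subst (_≤ o / n) (m*n/n≡m m n) (/-monoˡ-≤ n le)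

/-unique : ∀ k m n .{{_ : NonZero n}} → k * n ≤ m → m < (k + 1) * n → m / n ≡ k
/-unique k m n lo hi = ≤-antisym
  (s≤s⁻¹ (subst (m / n <_) (+-comm k 1) (m<n*o⇒m/o<n hi)))
  (m*n≤o⇒m≤o/n k n m lo)

∈⊎∉ : ∀ (S : SubsetN) x → x ∈ S ⊎ x ∉ S
∈⊎∉ S x with S x
... | true  = inj₁ refl
... | false = inj₂ λ ()

∈-∖⁺ : ∀ (T A : SubsetN) {x} → x ∈ T → x ∉ A → x ∈ T ∖ A
∈-∖⁺ T A {x} x∈T x∉A rewrite x∈T | ¬-not x∉A = refl

∈-∖⁻ : ∀ (T A : SubsetN) {x} → x ∈ T ∖ A → x ∈ T × x ∉ A
∈-∖⁻ T A {x} x∈T∖A with T x | A x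
... | true | false = refl , λ ()

∉-∖ : ∀ (T A : SubsetN) {x} → x ∈ A → x ∉ T ∖ A
∉-∖ T A {x} x∈A rewrite x∈A with T x
... | true  = λ ()
... | false = λ ()

⊆⇒∖∖-same : ∀ (S T : SubsetN) → (∀ x → x ∈ S → x ∈ T) → SameSet S (T ∖ (T ∖ S))
⊆⇒∖∖-same S T S⊆T x = mk⇔ to from
  where
  to : x ∈ S → x ∈ T ∖ (T ∖ S)
  to x∈S = ∈-∖⁺ T (T ∖ S) (S⊆T x x∈S) (λ x∈T∖S → proj₂ (∈-∖⁻ T S x∈T∖S) x∈S)
  from : x ∈ T ∖ (T ∖ S) → x ∈ S
  from h with ∈-∖⁻ T (T ∖ S) h | ∈⊎∉ S x
  ... | _   , _     | inj₁ x∈S = x∈S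
  ... | x∈T , x∉T∖S | inj₂ x∉S = contradiction (∈-∖⁺ T S x∈T x∉S) x∉T∖S

∉⇒≤frobenius : ∀ (S : SubsetN) {g x} → IsFrobenius S g → x ∉ S → x ≤ g
∉⇒≤frobenius S (_ , >g⇒∈) x∉S = ≮⇒≥ λ g<x → x∉S (>g⇒∈ _ g<x)

frobenius-unique : ∀ (S : SubsetN) {g g′} → IsFrobenius S g → IsFrobenius S g′ → g ≡ g′
frobenius-unique S F@(g∉S , _) F′@(g′∉S , _) =
  ≤-antisym (∉⇒≤frobenius S F′ g∉S) (∉⇒≤frobenius S F g′∉S)

frobenius-exists : ∀ (U : SubsetN) {N a} → (∀ y → N ≤ y → y ∈ U) → a ∉ U →
                   ∃[ g ] IsFrobenius U g
frobenius-exists U {zero} cofinite a∉U = contradiction (cofinite _ z≤n) a∉U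
frobenius-exists U {suc n} {a} cofinite a∉U =
  largest-gap n (s≤s⁻¹ (≰⇒> λ N≤a → a∉U (cofinite _ N≤a))) cofinite
  where
  largest-gap : ∀ n → a ≤ n → (∀ y → n < y → y ∈ U) → ∃[ g ] IsFrobenius U g
  largest-gap n a≤n above with ∈⊎∉ U n
  ... | inj₂ n∉U = n , n∉U , above
  ... | inj₁ n∈U with m≤n⇒m<n∨m≡n a≤n
  ...   | inj₂ refl = contradiction n∈U a∉U
  ...   | inj₁ (s≤s {n = k} a≤k) = largest-gap k a≤k above′
    where
    above′ : ∀ y → k < y → y ∈ U
    above′ y k<y with m≤n⇒m<n∨m≡n k<y
    ... | inj₁ n<y  = above y n<y
    ... | inj₂ refl = n∈U

*-closed : ∀ (S : SubsetN) {m} → IsNumericalSemigroup S → m ∈ S → ∀ k → k * m ∈ S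
*-closed S (0∈S , _ , _) m∈S zero = 0∈S
*-closed S NS@(_ , +-closed , _) m∈S (suc k) = +-closed _ _ m∈S (*-closed S NS m∈S k)

msg≤frobenius+multiplicity : ∀ (T : SubsetN) {m f x} → IsMultiplicity T m → IsFrobenius T f →
                             InMsg T x → x ≤ f + m
msg≤frobenius+multiplicity T {m} {f} {x} (0<m , m∈T , _) (_ , >f⇒∈) (_ , _ , indecomposable) =
  ≮⇒≥ λ f+m<x →
    let f<x∸m = m+n≤o⇒m≤o∸n (suc f) f+m<x
        m≤x = ≤-trans (m≤n+m m f) (<⇒≤ f+m<x)
    in indecomposable (m , x ∸ m , m∈T , >f⇒∈ _ f<x∸m , 0<m , <-≤-trans z<s f<x∸m , m+[n∸m]≡n m≤x)

∖-msg-isNumericalSemigroup : ∀ (T A : SubsetN) {b} → IsNumericalSemigroup T →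
  (∀ x → x ∈ A → InMsg T x) → (∀ x → x ∈ A → x ≤ b) → IsNumericalSemigroup (T ∖ A)
∖-msg-isNumericalSemigroup T A {b} (0∈T , +-closed , N , cofinite) A⊆msg A≤b =
  ∈-∖⁺ T A 0∈T (λ 0∈A → <-irrefl refl (proj₁ (proj₂ (A⊆msg 0 0∈A)))) ,
  closed , N + suc b , large∈
  where
  sum∉A : ∀ x y → x ∈ T → y ∈ T → x ∉ A → y ∉ A → x + y ∉ A
  sum∉A zero    y       _   _   _   y∉A = y∉A
  sum∉A (suc x) zero    _   _   x∉A _   = subst (_∉ A) (sym (+-identityʳ (suc x))) x∉A
  sum∉A (suc x) (suc y) x∈T y∈T _   _   x+y∈A =
    proj₂ (proj₂ (A⊆msg _ x+y∈A)) (suc x , suc y , x∈T , y∈T , z<s , z<s , refl)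

  closed : ∀ x y → x ∈ T ∖ A → y ∈ T ∖ A → x + y ∈ T ∖ A
  closed x y x∈ y∈ with ∈-∖⁻ T A x∈ | ∈-∖⁻ T A y∈
  ... | x∈T , x∉A | y∈T , y∉A = ∈-∖⁺ T A (+-closed x y x∈T y∈T) (sum∉A x y x∈T y∈T x∉A y∉A)

  large∈ : ∀ y → N + suc b ≤ y → y ∈ T ∖ A
  large∈ y N+b<y = ∈-∖⁺ T A (cofinite y (≤-trans (m≤m+n N (suc b)) N+b<y))
    λ y∈A → <⇒≱ (≤-trans (m≤n+m (suc b) N) N+b<y) (A≤b y y∈A)

∖-isMultiplicity : ∀ (T A : SubsetN) {m} → IsMultiplicity T m → m ∉ A → IsMultiplicity (T ∖ A) m
∖-isMultiplicity T A (0<m , m∈T , below∉T) m∉A =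
  0<m , ∈-∖⁺ T A m∈T m∉A , λ x 0<x x<m x∈T∖A → below∉T x 0<x x<m (proj₁ (∈-∖⁻ T A x∈T∖A))

module RemovingLargeGenerators
  (m : ℕ) .{{_ : NonZero m}} (T : SubsetN) (NST : IsNumericalSemigroup T)
  (MT : IsMultiplicity T m) (f : ℕ) (FT : IsFrobenius T f)
  (A : SubsetN) (A-removable : ∀ x → x ∈ A → Removable m T f x)
  where

  private
    S : SubsetN
    S = T ∖ A

    q : ℕ
    q = f / m

  A⊆msg : ∀ x → x ∈ A → InMsg T x
  A⊆msg x x∈A = proj₁ (A-removable x x∈A)

  A≤f+m : ∀ x → x ∈ A → x ≤ f + m
  A≤f+m x x∈A = msg≤frobenius+multiplicity T MT FT (A⊆msg x x∈A)

  m∉A : m ∉ A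
  m∉A m∈A = <⇒≱ (proj₂ (A-removable m m∈A))
    (subst (m ≤_) (sym ([m+1]*n≡m*n+n q m)) (m≤n+m m (q * m)))

  isNumericalSemigroup : IsNumericalSemigroup S
  isNumericalSemigroup = ∖-msg-isNumericalSemigroup T A NST A⊆msg A≤f+m

  isMultiplicity : IsMultiplicity S m
  isMultiplicity = ∖-isMultiplicity T A MT m∉A

  ∉S⇒≤f+m : ∀ {x} → x ∉ S → x ≤ f + m
  ∉S⇒≤f+m {x} x∉S with ∈⊎∉ A x
  ... | inj₁ x∈A = A≤f+m x x∈A
  ... | inj₂ x∉A = ≤-trans (∉⇒≤frobenius T FT (λ x∈T → x∉S (∈-∖⁺ T A x∈T x∉A)))
                        (m≤m+n f m)

  frobenius/m≡q+1 : ∀ {a g} → a ∈ A → IsFrobenius S g → g / m ≡ q + 1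
  frobenius/m≡q+1 {a} {g} a∈A FS@(g∉S , _) = /-unique (q + 1) g m
    (≤-trans (<⇒≤ (proj₂ (A-removable a a∈A))) (∉⇒≤frobenius S FS (∉-∖ T A a∈A)))
    (begin-strict
      g                    ≤⟨ ∉S⇒≤f+m g∉S ⟩
      f + m                <⟨ +-monoˡ-< m (m<[m/n+1]*n f m) ⟩
      (q + 1) * m + m      ≡⟨ [m+1]*n≡m*n+n (q + 1) m ⟨
      (q + 1 + 1) * m      ∎)
    where open ≤-Reasoning

  T⇔S∪γS : ∀ {a} → a ∈ A → ∀ x → (x ∈ T) ⇔ ((x ∈ S) ⊎ InGamma m S x)
  T⇔S∪γS {a} a∈A x = mk⇔ to from
    where
    to : x ∈ T → (x ∈ S) ⊎ InGamma m S x
    to x∈T with ∈⊎∉ A x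
    ... | inj₂ x∉A = inj₁ (∈-∖⁺ T A x∈T x∉A)
    ... | inj₁ x∈A =
      let g , FS = frobenius-exists S (proj₂ (proj₂ (proj₂ isNumericalSemigroup))) (∉-∖ T A a∈A)
      in inj₂ (∉-∖ T A x∈A , g , FS
              , subst (λ k → k * m ≤ x) (sym (frobenius/m≡q+1 a∈A FS)) (<⇒≤ (proj₂ (A-removable x x∈A)))
              , ∉⇒≤frobenius S FS (∉-∖ T A x∈A))

    from : (x ∈ S) ⊎ InGamma m S x → x ∈ T
    from (inj₁ x∈S) = proj₁ (∈-∖⁻ T A x∈S)
    from (inj₂ (_ , g , FS , [g/m]*m≤x , _)) = proj₂ FT x (<-≤-trans (m<[m/n+1]*n f m)
      (subst (λ k → k * m ≤ x) (frobenius/m≡q+1 a∈A FS) [g/m]*m≤x))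

  isChild : ∀ {a} → a ∈ A → IsChild m T S
  isChild a∈A = isNumericalSemigroup , isMultiplicity
    , (λ S≡T → ∉-∖ T A a∈A (Equivalence.from (S≡T _) (proj₁ (A⊆msg _ a∈A))))
    , T⇔S∪γS a∈A

module ChildOf
  (m : ℕ) .{{_ : NonZero m}} (2≤m : 2 ≤ m) (T : SubsetN)
  (MT : IsMultiplicity T m) (f : ℕ) (FT : IsFrobenius T f)
  (S : SubsetN) (NSS : IsNumericalSemigroup S) (MS : IsMultiplicity S m)
  (T⇔S∪γS : ∀ x → (x ∈ T) ⇔ ((x ∈ S) ⊎ InGamma m S x))
  where

  private
    q : ℕ
    q = f / m

  S⊆T : ∀ x → x ∈ S → x ∈ T
  S⊆T x x∈S = Equivalence.from (T⇔S∪γS x) (inj₁ x∈S)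

  γS⊆T : ∀ x → InGamma m S x → x ∈ T
  γS⊆T x x∈γS = Equivalence.from (T⇔S∪γS x) (inj₂ x∈γS)

  frobenius : ∃[ g ] IsFrobenius S g
  frobenius = frobenius-exists S (proj₂ (proj₂ (proj₂ NSS))) (proj₂ (proj₂ MS) 1 z<s 2≤m)

  g : ℕ
  g = proj₁ frobenius

  FS : IsFrobenius S g
  FS = proj₂ frobenius

  private
    p : ℕ
    p = g / m

  gap-window : ∀ {x} → x ∈ T → x ∉ S → p * m ≤ x × x ≤ g
  gap-window {x} x∈T x∉S with Equivalence.to (T⇔S∪γS x) x∈T
  ... | inj₁ x∈S = contradiction x∈S x∉S
  ... | inj₂ (_ , g′ , FS′ , [g′/m]*m≤x , x≤g′) rewrite frobenius-unique S FS′ FS = [g′/m]*m≤x , x≤g′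

  f<p*m : f < p * m
  f<p*m = ≰⇒> λ p*m≤f →
    let f∉S = λ f∈S → proj₁ FT (S⊆T f f∈S)
    in proj₁ FT (γS⊆T f (f∉S , g , FS , p*m≤f , ∉⇒≤frobenius S FS f∉S))

  gap>[q+1]*m : ∀ {x} → x ∈ T → x ∉ S → (q + 1) * m < x
  gap>[q+1]*m {x} x∈T x∉S = begin-strict
    (q + 1) * m  ≤⟨ *-monoˡ-≤ m (subst (_≤ p) (+-comm 1 q) (m<n*o⇒m/o<n f<p*m)) ⟩
    p * m        <⟨ ≤∧≢⇒< (proj₁ (gap-window x∈T x∉S)) p*m≢x ⟩
    x            ∎
    where
    open ≤-Reasoning
    p*m≢x : p * m ≢ x
    p*m≢x p*m≡x = x∉S (subst (_∈ S) p*m≡x (*-closed S NSS (proj₁ (proj₂ MS)) p))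

  gap+positive≢gap : ∀ {a b x} → a ∈ T → a ∉ S → b ∈ T → 0 < b → x ∈ T → x ∉ S → a + b ≢ x
  gap+positive≢gap {a} {b} {x} a∈T a∉S b∈T 0<b x∈T x∉S a+b≡x =
    proj₂ (proj₂ MT) b 0<b b<m b∈T
    where
    open ≤-Reasoning
    b<m : b < m
    b<m = +-cancelˡ-< (p * m) b m (begin-strict
      p * m + b  ≤⟨ +-monoˡ-≤ b (proj₁ (gap-window a∈T a∉S)) ⟩
      a + b      ≡⟨ a+b≡x ⟩
      x          ≤⟨ proj₂ (gap-window x∈T x∉S) ⟩
      g          <⟨ m<[m/n+1]*n g m ⟩
      (p + 1) * m ≡⟨ [m+1]*n≡m*n+n p m ⟩
      p * m + m  ∎)

  gap-isMsg : ∀ {x} → x ∈ T → x ∉ S → InMsg T x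
  gap-isMsg {x} x∈T x∉S = x∈T , 0<x , indecomposable
    where
    0<x : 0 < x
    0<x = ≤∧≢⇒< z≤n λ 0≡x → x∉S (subst (_∈ S) 0≡x (proj₁ NSS))

    indecomposable : ¬ (∃[ a ] ∃[ b ] ((a ∈ T) × (b ∈ T) × (0 < a) × (0 < b) × (a + b ≡ x)))
    indecomposable (a , b , a∈T , b∈T , 0<a , 0<b , a+b≡x) with ∈⊎∉ S a | ∈⊎∉ S b
    ... | inj₂ a∉S | _        = gap+positive≢gap a∈T a∉S b∈T 0<b x∈T x∉S a+b≡x
    ... | inj₁ _   | inj₂ b∉S = gap+positive≢gap b∈T b∉S a∈T 0<a x∈T x∉S (trans (+-comm b a) a+b≡x)
    ... | inj₁ a∈S | inj₁ b∈S = x∉S (subst (_∈ S) a+b≡x (proj₁ (proj₂ NSS) a b a∈S b∈S))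

  gaps-removable : ∀ x → x ∈ T ∖ S → Removable m T f x
  gaps-removable x x∈T∖S with ∈-∖⁻ T S x∈T∖S
  ... | x∈T , x∉S = gap-isMsg x∈T x∉S , gap>[q+1]*m x∈T x∉S

  frobenius∈T∖S : g ∈ T ∖ S
  frobenius∈T∖S = ∈-∖⁺ T S (γS⊆T g (proj₁ FS , g , FS , m/n*n≤m g m , ≤-refl)) (proj₁ FS)

proposition29 : (m : ℕ) → .{{_ : NonZero m}} → 2 ≤ m →
    (T : SubsetN) → IsNumericalSemigroup T → IsMultiplicity T m →
    (f : ℕ) → IsFrobenius T f →
    ((S : SubsetN) → IsChild m T S →
       ∃[ A ] ((∃[ a ] (a ∈ A)) × (∀ x → x ∈ A → Removable m T f x) × SameSet S (T ∖ A)))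
    × ((A : SubsetN) → (∃[ a ] (a ∈ A)) → (∀ x → x ∈ A → Removable m T f x) →
       IsChild m T (T ∖ A))
proposition29 m 2≤m T NST MT f FT = child⇒removal , removal⇒child
  where
  child⇒removal : (S : SubsetN) → IsChild m T S →
    ∃[ A ] ((∃[ a ] (a ∈ A)) × (∀ x → x ∈ A → Removable m T f x) × SameSet S (T ∖ A))
  child⇒removal S (NSS , MS , _ , T⇔S∪γS) =
    T ∖ S , (g , frobenius∈T∖S) , gaps-removable , ⊆⇒∖∖-same S T S⊆T
    where open ChildOf m 2≤m T MT f FT S NSS MS T⇔S∪γS

  removal⇒child : (A : SubsetN) → (∃[ a ] (a ∈ A)) → (∀ x → x ∈ A → Removable m T f x) →
    IsChild m T (T ∖ A)
  removal⇒child A (_ , a∈A) A-removable =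
    RemovingLargeGenerators.isChild m T NST MT f FT A A-removable a∈A
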